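{- Let $G$ and $H$ be finite simple undirected graphs, where $G$ has $s_1$ vertices and $t_1$ edges and $H$ has $s_2$ vertices and $t_2$ edges. Then $$Mo(G\circ H)\le s_1\,irr(H)+(s_2+1)\,Mo(G)+s_1s_2\,\left|2-s_1-s_1s_2\right|+2s_1t_2 .$$
   Context: For a graph $X$ and an edge $e=uv$ of $X$, $n_u(e\mid X)$ denotes the number of vertices $w$ of $X$ with $d_X(w,u)<d_X(w,v)$ ($d_X$ the shortest-path distance). The Mostar index is $Mo(X)=\sum_{uv\in E(X)}|n_u(e\mid X)-n_v(e\mid X)|$. The irregularity is $irr(X)=\sum_{uv\in E(X)}|\deg_X(u)-\deg_X(v)|$. The corona product $G\circ H$ is obtained from one copy of $G$ and $s_1$ disjoint copies of $H$ by joining the $g$-th vertex of $G$ to every vertex of the $g$-th copy of $H$, $1\le g\le s_1$. -}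

module Defs where

open import Data.Nat using (ℕ; zero; suc; _+_; _*_; _<ᵇ_; ∣_-_∣)
open import Data.Bool using (Bool; true; false; _∧_; _∨_; if_then_else_)
open import Data.Bool.Properties using (∧-zeroʳ; ∧-comm)
open import Data.Fin using (Fin; toℕ; splitAt; remQuot)
open import Data.Fin.Properties using (_≟_)
open import Data.List using (List; map; allFin)
open import Data.Nat.ListAction using (sum)
open import Data.Bool.ListAction using (any)
open import Data.Maybe using (Maybe; just; nothing)
open import Data.Product using (_×_; _,_)
open import Data.Sum using (_⊎_; inj₁; inj₂)
open import Relation.Nullary using (yes; no)
open import Relation.Nullary.Decidable using (⌊_⌋)
open import Relation.Binary.PropositionalEquality using (_≡_; refl; cong₂; sym)

record Graph : Set where
  field
    n      : ℕ
    adj    : Fin n → Fin n → Bool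
    adjSym : ∀ i j → adj i j ≡ adj j i
    irrefl : ∀ i → adj i i ≡ false
open Graph public

_==_ : ∀ {k} → Fin k → Fin k → Bool
a == b = ⌊ a ≟ b ⌋

count : ∀ {k} → (Fin k → Bool) → ℕ
count {k} p = sum (map (λ i → if p i then 1 else 0) (allFin k))

sumFin : ∀ {k} → (Fin k → ℕ) → ℕ
sumFin {k} f = sum (map f (allFin k))

edgeSum : (X : Graph) → (Fin (n X) → Fin (n X) → ℕ) → ℕ
edgeSum X f = sumFin (λ i → sumFin (λ j →
  if adj X i j ∧ (toℕ i <ᵇ toℕ j) then f i j else 0))

deg : (X : Graph) → Fin (n X) → ℕ
deg X i = count (adj X i)

reach : (X : Graph) → ℕ → Fin (n X) → Fin (n X) → Bool
reach X zero    w u = w == u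
reach X (suc k) w u =
  reach X k w u ∨ any (λ x → reach X k w x ∧ adj X x u) (allFin (n X))

-- shortest-path distance; nothing = ∞ (different components)
distAux : (X : Graph) → ℕ → ℕ → Fin (n X) → Fin (n X) → Maybe ℕ
distAux X k zero       w u = if reach X k w u then just k else nothing
distAux X k (suc fuel) w u =
  if reach X k w u then just k else distAux X (suc k) fuel w u

dist : (X : Graph) → Fin (n X) → Fin (n X) → Maybe ℕ
dist X w u = distAux X 0 (n X) w u

_<∞_ : Maybe ℕ → Maybe ℕ → Bool
just a  <∞ just b  = a <ᵇ b
just _  <∞ nothing = true
nothing <∞ _       = false

nCloser : (X : Graph) → Fin (n X) → Fin (n X) → ℕ
nCloser X u v = count (λ w → dist X w u <∞ dist X w v)

Mo : Graph → ℕ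
Mo X = edgeSum X (λ u v → ∣ nCloser X u v - nCloser X v u ∣)

irr : Graph → ℕ
irr X = edgeSum X (λ u v → ∣ deg X u - deg X v ∣)

edges : Graph → ℕ
edges X = edgeSum X (λ _ _ → 1)

-- Vertex set Fin (s₁ + s₁ * s₂): the first s₁
-- vertices are those of G; a vertex in the second block corresponds via
-- remQuot to a pair (g , h) = vertex h of the g-th copy of H.
private
  ==-sym : ∀ {k} (a b : Fin k) → (a == b) ≡ (b == a)
  ==-sym a b with a ≟ b | b ≟ a
  ... | yes _ | yes _ = refl
  ... | no _  | no _  = refl
  ... | yes p | no q  = Data.Empty.⊥-elim (q (sym p)) where import Data.Empty
  ... | no p  | yes q = Data.Empty.⊥-elim (p (sym q)) where import Data.Empty

  ==-refl : ∀ {k} (a : Fin k) → (a == a) ≡ true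
  ==-refl a with a ≟ a
  ... | yes _ = refl
  ... | no p  = Data.Empty.⊥-elim (p refl) where import Data.Empty

coronaVertex : (s₁ s₂ : ℕ) → Fin (s₁ + s₁ * s₂) → Fin s₁ ⊎ (Fin s₁ × Fin s₂)
coronaVertex s₁ s₂ i with splitAt s₁ i
... | inj₁ g = inj₁ g
... | inj₂ p = inj₂ (remQuot s₂ p)

coronaAdjV : (G H : Graph) → Fin (n G) ⊎ (Fin (n G) × Fin (n H))
           → Fin (n G) ⊎ (Fin (n G) × Fin (n H)) → Bool
coronaAdjV G H (inj₁ g)       (inj₁ g')        = adj G g g'
coronaAdjV G H (inj₁ g)       (inj₂ (g' , _))  = g == g'
coronaAdjV G H (inj₂ (g , _)) (inj₁ g')        = g == g'
coronaAdjV G H (inj₂ (g , h)) (inj₂ (g' , h')) = (g == g') ∧ adj H h h'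

private
  coronaAdjV-sym : ∀ G H x y → coronaAdjV G H x y ≡ coronaAdjV G H y x
  coronaAdjV-sym G H (inj₁ g) (inj₁ g') = adjSym G g g'
  coronaAdjV-sym G H (inj₁ g) (inj₂ (g' , _)) = ==-sym g g'
  coronaAdjV-sym G H (inj₂ (g , _)) (inj₁ g') = ==-sym g g'
  coronaAdjV-sym G H (inj₂ (g , h)) (inj₂ (g' , h')) =
    cong₂ _∧_ (==-sym g g') (adjSym H h h')

  coronaAdjV-irr : ∀ G H x → coronaAdjV G H x x ≡ false
  coronaAdjV-irr G H (inj₁ g) = irrefl G g
  coronaAdjV-irr G H (inj₂ (g , h)) with adj H h h | irrefl H h
  ... | .false | refl = ∧-zeroʳ (g == g)

corona : Graph → Graph → Graph
corona G H = record
  { n      = n G + n G * n H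
  ; adj    = λ i j → coronaAdjV G H (cv i) (cv j)
  ; adjSym = λ i j → coronaAdjV-sym G H (cv i) (cv j)
  ; irrefl = λ i → coronaAdjV-irr G H (cv i)
  }
  where
  cv = coronaVertex (n G) (n H)

-- In G ∘ H every vertex of the g-th copy of H is adjacent to g, so its distances agree
-- with those of g up to one step, and two vertices of one copy are at distance at most 2.
-- Hence, for an edge gg′ of G, every copy of H sides with its own vertex of G, giving
-- n_g = (s₂ + 1) n_g(G): these edges contribute (s₂ + 1) Mo(G). For an edge hh′ inside a
-- copy, only vertices of that copy can be strictly closer to one end, and n_h differs by
-- at most one from the number of neighbours of h not adjacent to h′; so |n_h − n_h′| is
-- at most |deg h − deg h′| + 2, and these edges contribute s₁ irr(H) + 2 s₁ t₂. Each of
-- the s₁ s₂ edges joining g to its copy satisfies the general bound |n_u − n_v| ≤ |V| − 2.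

module Submission where

open import Defs
open import Data.Bool using (Bool; true; false; _∧_; _∨_; not; if_then_else_)
open import Data.Bool.ListAction using (any)
open import Data.Bool.Properties
  using (⇔→≡; T-≡; T-not-≡; ∧-conicalˡ; ∧-conicalʳ; ∧-comm; ∧-zeroʳ; ∨-zeroʳ; ¬-not; not-¬)
import Data.Bool.Properties as Bool
open import Data.Empty using (⊥)
open import Data.Fin using (Fin; zero; suc; toℕ; _↑ˡ_; _↑ʳ_; join; splitAt; combine)
import Data.Fin.Properties as Fin
open import Data.List using (map; tabulate; allFin)
open import Data.List.Membership.Propositional using (lose)
open import Data.List.Membership.Propositional.Properties using (∈-allFin)
open import Data.List.Relation.Unary.Any using (satisfied)
open import Data.List.Relation.Unary.Any.Properties using (any⁺; any⁻)
open import Data.Maybe using (just; nothing)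
open import Data.Maybe.Properties using (just-injective)
open import Data.Nat
  using (ℕ; zero; suc; _+_; _*_; _∸_; _⊔_; _≤_; _<_; _≤′_; ≤′-refl; ≤′-step; _<ᵇ_; z≤n; s≤s; ∣_-_∣)
import Data.Nat.ListAction as List
open import Data.Nat.Properties
open import Algebra.Properties.Semiring.Sum +-*-semiring
  using (sum; sum-syntax; sum-cong-≗; ∑-distrib-+; *-distribˡ-sum; sum-replicate-zero)
open import Data.Nat.Tactic.RingSolver using (solve-∀)
open import Data.Product using (_×_; _,_; proj₁; proj₂; ∃-syntax; uncurry; map₂)
open import Data.Sum using (_⊎_; inj₁; inj₂)
import Data.Sum
open import Function using (_∘_; id; Equivalence; mk⇔; case_of_)
open import Relation.Binary.PropositionalEquality
open import Relation.Nullary using (¬_; yes; no; contradiction; ¬?)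
open import Relation.Nullary.Decidable
  using (toWitness; fromWitness; fromWitnessFalse; decidable-stable; _×-dec_)

-- Indicators, finite sums and counting

indicator : Bool → ℕ
indicator b = if b then 1 else 0

indicator-mono : ∀ {a b} → (a ≡ true → b ≡ true) → indicator a ≤ indicator b
indicator-mono {false} a⇒b = z≤n
indicator-mono {true}  a⇒b rewrite a⇒b refl = ≤-refl

indicator-false : ∀ {b} → ¬ b ≡ true → indicator b ≡ 0
indicator-false {false} _  = refl
indicator-false {true}  ¬b = contradiction refl ¬b

indicator-⊎ : ∀ {a b c} → (a ≡ true → b ≡ true ⊎ c ≡ true) → indicator a ≤ indicator b + indicator c
indicator-⊎ {false}         _ = z≤n
indicator-⊎ {true} {b} {c} a⇒b⊎c with a⇒b⊎c refl
... | inj₁ refl = s≤s z≤n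
... | inj₂ refl = m≤n+m 1 (indicator b)

∧-true : ∀ {a b} → a ∧ b ≡ true → a ≡ true × b ≡ true
∧-true e = ∧-conicalˡ _ _ e , ∧-conicalʳ _ _ e

==⇒≡ : ∀ {k} {a b : Fin k} → (a == b) ≡ true → a ≡ b
==⇒≡ = toWitness ∘ Equivalence.from T-≡

≡⇒== : ∀ {k} {a b : Fin k} → a ≡ b → (a == b) ≡ true
≡⇒== = Equivalence.to T-≡ ∘ fromWitness

≢⇒== : ∀ {k} {a b : Fin k} → a ≢ b → (a == b) ≡ false
≢⇒== = Equivalence.to T-not-≡ ∘ fromWitnessFalse

any-allFin⁻ : ∀ {k} (p : Fin k → Bool) → any p (allFin k) ≡ true → ∃[ i ] p i ≡ true
any-allFin⁻ {k} p = map₂ (Equivalence.to T-≡) ∘ satisfied ∘ any⁻ p (allFin k) ∘ Equivalence.from T-≡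

any-allFin⁺ : ∀ {k} (p : Fin k → Bool) (i : Fin k) → p i ≡ true → any p (allFin k) ≡ true
any-allFin⁺ p i = Equivalence.to T-≡ ∘ any⁺ p ∘ lose (∈-allFin i) ∘ Equivalence.from T-≡

sum-map-tabulate : ∀ {A : Set} {k} (f : A → ℕ) (g : Fin k → A) →
                   List.sum (map f (tabulate g)) ≡ ∑[ i < k ] f (g i)
sum-map-tabulate {k = zero}  f g = refl
sum-map-tabulate {k = suc k} f g = cong (f (g zero) +_) (sum-map-tabulate f (g ∘ suc))

sumFin≡∑ : ∀ {k} (f : Fin k → ℕ) → sumFin f ≡ ∑[ i < k ] f i
sumFin≡∑ f = sum-map-tabulate f id

∑-const : ∀ k c → ∑[ i < k ] c ≡ k * c
∑-const zero    c = refl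
∑-const (suc k) c = cong (c +_) (∑-const k c)

∑-mono-≤ : ∀ {k} {f g : Fin k → ℕ} → (∀ i → f i ≤ g i) → sum f ≤ sum g
∑-mono-≤ {zero}  f≤g = z≤n
∑-mono-≤ {suc k} f≤g = +-mono-≤ (f≤g zero) (∑-mono-≤ (f≤g ∘ suc))

∑-mono-< : ∀ {k} {f g : Fin k → ℕ} (j : Fin k) → (∀ i → f i ≤ g i) → f j < g j → sum f < sum g
∑-mono-< zero    f≤g f<g = +-mono-<-≤ f<g (∑-mono-≤ (f≤g ∘ suc))
∑-mono-< (suc j) f≤g f<g = +-mono-≤-< (f≤g zero) (∑-mono-< j (f≤g ∘ suc) f<g)

term≤∑ : ∀ {k} (f : Fin k → ℕ) (j : Fin k) → f j ≤ sum f
term≤∑ f zero    = m≤m+n _ _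
term≤∑ f (suc j) = ≤-trans (term≤∑ (f ∘ suc) j) (m≤n+m _ (f zero))

∑-zero : ∀ {k} (f : Fin k → ℕ) → (∀ i → f i ≡ 0) → sum f ≡ 0
∑-zero {k} f vanish = trans (sum-cong-≗ vanish) (sum-replicate-zero k)

∑-single : ∀ {k} (f : Fin k → ℕ) (j : Fin k) → (∀ i → i ≢ j → f i ≡ 0) → sum f ≡ f j
∑-single {suc k} f zero    vanish =
  trans (cong (f zero +_) (∑-zero (f ∘ suc) (λ i → vanish (suc i) λ ()))) (+-identityʳ _)
∑-single {suc k} f (suc j) vanish =
  cong₂ _+_ (vanish zero λ ())
            (∑-single (f ∘ suc) j (λ i i≢j → vanish (suc i) (i≢j ∘ Fin.suc-injective)))

∑-select : ∀ {m k} (x : Fin m) (f : Fin k → ℕ) →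
           ∑[ y < m ] ∑[ j < k ] (if x == y then f j else 0) ≡ ∑[ j < k ] f j
∑-select x f =
  trans (∑-single _ x λ y y≢x → ∑-zero _ λ j → cong (if_then f j else 0) (≢⇒== (y≢x ∘ sym)))
        (sum-cong-≗ λ j → cong (if_then f j else 0) (≡⇒== refl))

∑-↑ : ∀ m n (f : Fin (m + n) → ℕ) → sum f ≡ ∑[ i < m ] f (i ↑ˡ n) + ∑[ j < n ] f (m ↑ʳ j)
∑-↑ zero    n f = refl
∑-↑ (suc m) n f = trans (cong (f zero +_) (∑-↑ m n (f ∘ suc))) (sym (+-assoc (f zero) _ _))

∑-combine : ∀ m n (f : Fin (m * n) → ℕ) → sum f ≡ ∑[ i < m ] ∑[ j < n ] f (combine i j)
∑-combine zero    n f = refl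
∑-combine (suc m) n f =
  trans (∑-↑ n (m * n) f) (cong (∑[ j < n ] f (j ↑ˡ (m * n)) +_) (∑-combine m n (f ∘ (n ↑ʳ_))))

count≡∑ : ∀ {k} (p : Fin k → Bool) → count p ≡ ∑[ i < k ] indicator (p i)
count≡∑ p = sumFin≡∑ (indicator ∘ p)

count≤ : ∀ {k} (p : Fin k → Bool) → count p ≤ k
count≤ {k} p = begin
  count p                       ≡⟨ count≡∑ p ⟩
  ∑[ i < k ] indicator (p i)    ≤⟨ ∑-mono-≤ (λ i → indicator≤1 (p i)) ⟩
  ∑[ i < k ] 1                  ≡⟨ trans (∑-const k 1) (*-identityʳ k) ⟩
  k                             ∎
  where
  open ≤-Reasoning
  indicator≤1 : ∀ b → indicator b ≤ 1
  indicator≤1 true  = ≤-refl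
  indicator≤1 false = z≤n

count-pos : ∀ {k} (p : Fin k → Bool) (i : Fin k) → p i ≡ true → 1 ≤ count p
count-pos p i pᵢ = begin
  1                               ≡⟨ cong indicator pᵢ ⟨
  indicator (p i)                 ≤⟨ term≤∑ (indicator ∘ p) i ⟩
  ∑[ j < _ ] indicator (p j)      ≡⟨ count≡∑ p ⟨
  count p                         ∎
  where open ≤-Reasoning

count-< : ∀ {k} (p q : Fin k → Bool) (i : Fin k) → (∀ j → p j ≡ true → q j ≡ true) →
          p i ≡ false → q i ≡ true → count p < count q
count-< p q i p⊆q ¬pᵢ qᵢ = subst₂ _<_ (sym (count≡∑ p)) (sym (count≡∑ q))
  (∑-mono-< i (λ j → indicator-mono (p⊆q j))
              (subst₂ (λ a b → indicator a < indicator b) (sym ¬pᵢ) (sym qᵢ) ≤-refl))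

count+count≤ : ∀ {k} (p q : Fin k → Bool) → (∀ i → p i ≡ true → q i ≡ true → ⊥) →
               count p + count q ≤ k
count+count≤ {k} p q disjoint = begin
  count p + count q
    ≡⟨ cong₂ _+_ (count≡∑ p) (count≡∑ q) ⟩
  ∑[ i < k ] indicator (p i) + ∑[ i < k ] indicator (q i)
    ≡⟨ ∑-distrib-+ (indicator ∘ p) (indicator ∘ q) ⟨
  ∑[ i < k ] (indicator (p i) + indicator (q i))
    ≤⟨ ∑-mono-≤ (λ i → indicator-disjoint (disjoint i)) ⟩
  ∑[ i < k ] 1
    ≡⟨ trans (∑-const k 1) (*-identityʳ k) ⟩
  k
    ∎
  where
  open ≤-Reasoning
  indicator-disjoint : ∀ {a b} → (a ≡ true → b ≡ true → ⊥) → indicator a + indicator b ≤ 1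
  indicator-disjoint {false} {false} _ = z≤n
  indicator-disjoint {false} {true}  _ = ≤-refl
  indicator-disjoint {true}  {false} _ = ≤-refl
  indicator-disjoint {true}  {true}  ¬both = contradiction refl (¬both refl)

count≤count+count : ∀ {k} (p q r : Fin k → Bool) → (∀ i → p i ≡ true → q i ≡ true ⊎ r i ≡ true) →
                    count p ≤ count q + count r
count≤count+count {k} p q r p⊆q∪r = begin
  count p                                                ≡⟨ count≡∑ p ⟩
  ∑[ i < k ] indicator (p i)                             ≤⟨ ∑-mono-≤ (λ i → indicator-⊎ (p⊆q∪r i)) ⟩
  ∑[ i < k ] (indicator (q i) + indicator (r i))         ≡⟨ ∑-distrib-+ (indicator ∘ q) (indicator ∘ r) ⟩
  ∑[ i < k ] indicator (q i) + ∑[ i < k ] indicator (r i) ≡⟨ cong₂ _+_ (count≡∑ q) (count≡∑ r) ⟨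
  count q + count r                                      ∎
  where open ≤-Reasoning

count-== : ∀ {k} (a : Fin k) → count (_== a) ≡ 1
count-== a = trans (count≡∑ (_== a)) (trans (∑-single _ a (λ i i≢a → cong indicator (≢⇒== i≢a)))
                                             (cong indicator (≡⇒== refl)))

∣m-n∣≤1 : ∀ {m n} → m ≤ 1 + n → n ≤ 1 + m → ∣ m - n ∣ ≤ 1
∣m-n∣≤1 {m} {n} m≤1+n n≤1+m with ∣m-n∣≡[m∸n]∨[n∸m] m n
... | inj₁ eq rewrite eq = m≤n+o⇒m∸n≤o m n (subst (m ≤_) (+-comm 1 n) m≤1+n)
... | inj₂ eq rewrite eq = m≤n+o⇒m∸n≤o n m (subst (n ≤_) (+-comm 1 m) n≤1+m)

∣m-n∣≤∣p-q∣+2 : ∀ {m n p q} → ∣ m - p ∣ ≤ 1 → ∣ n - q ∣ ≤ 1 → ∣ m - n ∣ ≤ ∣ p - q ∣ + 2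
∣m-n∣≤∣p-q∣+2 {m} {n} {p} {q} m≈p n≈q = begin
  ∣ m - n ∣                             ≤⟨ ∣-∣-triangle m p n ⟩
  ∣ m - p ∣ + ∣ p - n ∣                 ≤⟨ +-monoʳ-≤ ∣ m - p ∣ (∣-∣-triangle p q n) ⟩
  ∣ m - p ∣ + (∣ p - q ∣ + ∣ q - n ∣)   ≤⟨ +-mono-≤ m≈p (+-monoʳ-≤ ∣ p - q ∣ q≈n) ⟩
  1 + (∣ p - q ∣ + 1)                   ≡⟨ trans (+-comm 1 (∣ p - q ∣ + 1)) (+-assoc ∣ p - q ∣ 1 1) ⟩
  ∣ p - q ∣ + 2                         ∎
  where
  open ≤-Reasoning
  q≈n : ∣ q - n ∣ ≤ 1
  q≈n = subst (_≤ 1) (∣-∣-comm n q) n≈q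

∣m-n∣≤m+n∸2 : ∀ {m n} → 1 ≤ m → 1 ≤ n → ∣ m - n ∣ ≤ m + n ∸ 2
∣m-n∣≤m+n∸2 {suc m} {suc n} _ _ = begin
  ∣ m - n ∣          ≤⟨ ∣m-n∣≤m⊔n m n ⟩
  m ⊔ n              ≤⟨ m⊔n≤m+n m n ⟩
  m + n              ≡⟨ cong (_∸ 1) (+-suc m n) ⟨
  suc m + suc n ∸ 2  ∎
  where open ≤-Reasoning

if-+ : ∀ b x y → (if b then x + y else 0) ≡ (if b then x else 0) + (if b then y else 0)
if-+ false x y = refl
if-+ true  x y = refl

if-* : ∀ b c x → (if b then c * x else 0) ≡ c * (if b then x else 0)
if-* false c x = sym (*-zeroʳ c)
if-* true  c x = refl

if-≤ : ∀ b x → (if b then x else 0) ≤ x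
if-≤ false x = z≤n
if-≤ true  x = ≤-refl

if-mono : ∀ b {x y} → x ≤ y → (if b then x else 0) ≤ (if b then y else 0)
if-mono false x≤y = z≤n
if-mono true  x≤y = x≤y

<ᵇ-+-cancelˡ : ∀ c a b → (c + a <ᵇ c + b) ≡ (a <ᵇ b)
<ᵇ-+-cancelˡ zero    a b = refl
<ᵇ-+-cancelˡ (suc c) a b = <ᵇ-+-cancelˡ c a b

-- Reachability and distances

-- A record rather than a synonym, so that k, w and u can be inferred from a proof.
record Reach (X : Graph) (k : ℕ) (w u : Fin (n X)) : Set where
  constructor reached
  field reach≡true : reach X k w u ≡ true
open Reach

Shortest : (X : Graph) → ℕ → Fin (n X) → Fin (n X) → Set
Shortest X j w u = Reach X j w u × (∀ i → i < j → ¬ Reach X i w u)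

closer : (X : Graph) → Fin (n X) → Fin (n X) → Fin (n X) → Bool
closer X w u v = dist X w u <∞ dist X w v

Closer : (X : Graph) → Fin (n X) → Fin (n X) → Fin (n X) → Set
Closer X w u v = ∃[ k ] Reach X k w u × ¬ Reach X k w v

module Distance (X : Graph) where

  private
    V = Fin (n X)

  reach-suc : ∀ {k w u} → Reach X k w u → Reach X (suc k) w u
  reach-suc {k} {w} {u} (reached r) =
    reached (cong (_∨ any (λ x → reach X k w x ∧ adj X x u) (allFin (n X))) r)

  reach-step : ∀ {k w x u} → Reach X k w x → adj X x u ≡ true → Reach X (suc k) w u
  reach-step {k} {w} {x} {u} (reached r) a = reached (trans
    (cong (reach X k w u ∨_) (any-allFin⁺ (λ y → reach X k w y ∧ adj X y u) x (cong₂ _∧_ r a)))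
    (∨-zeroʳ _))

  reach-inv : ∀ {k w u} → Reach X (suc k) w u →
              Reach X k w u ⊎ ∃[ x ] Reach X k w x × adj X x u ≡ true
  reach-inv {k} {w} {u} (reached r) with reach X k w u in eq
  ... | true  = inj₁ (reached eq)
  ... | false = inj₂ (map₂ (λ e → let (rx , a) = ∧-true e in reached rx , a) (any-allFin⁻ _ r))

  reach-mono′ : ∀ {i j w u} → i ≤′ j → Reach X i w u → Reach X j w u
  reach-mono′ ≤′-refl        r = r
  reach-mono′ (≤′-step i≤′j) r = reach-suc (reach-mono′ i≤′j r)

  reach-mono : ∀ {i j w u} → i ≤ j → Reach X i w u → Reach X j w u
  reach-mono = reach-mono′ ∘ ≤⇒≤′

  reach-refl : ∀ {k} w → Reach X k w w
  reach-refl w = reach-mono z≤n (reached (≡⇒== refl))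

  reach-≡ : ∀ {k w u} → w ≡ u → Reach X k w u
  reach-≡ refl = reach-refl _

  reach-zero : ∀ {w u} → Reach X 0 w u → w ≡ u
  reach-zero = ==⇒≡ ∘ reach≡true

  Stable : V → ℕ → Set
  Stable w i = ∀ {u} → Reach X (suc i) w u → Reach X i w u

  stable-persists : ∀ {i j w u} → Stable w i → i ≤′ j → Reach X j w u → Reach X i w u
  stable-persists s ≤′-refl        r = r
  stable-persists s (≤′-step i≤′j) r with reach-inv r
  ... | inj₁ r′           = stable-persists s i≤′j r′
  ... | inj₂ (x , rx , a) = s (reach-step (stable-persists s i≤′j rx) a)

  stable-or-grows : ∀ w i → Stable w i ⊎ ∃[ u ] Reach X (suc i) w u × ¬ Reach X i w u
  stable-or-grows w i
    with Fin.any? (λ u → (reach X (suc i) w u Bool.≟ true) ×-dec ¬? (reach X i w u Bool.≟ true))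
  ... | yes (u , r , ¬r) = inj₂ (u , reached r , ¬r ∘ reach≡true)
  ... | no ¬grows = inj₁ λ {u} r → reached (decidable-stable (reach X i w u Bool.≟ true)
                                              (λ ¬r → ¬grows (u , reach≡true r , ¬r)))

  -- The reachable set grows strictly until it stops growing, so it is stable after n X
  -- steps; this is why the fuel n X in dist suffices.
  stable-or-large : ∀ w j → (∃[ i ] i < j × Stable w i) ⊎ j < count (reach X j w)
  stable-or-large w zero = inj₂ (count-pos (reach X 0 w) w (≡⇒== refl))
  stable-or-large w (suc j) with stable-or-large w j
  ... | inj₁ (i , i<j , s) = inj₁ (i , m<n⇒m<1+n i<j , s)
  ... | inj₂ j<count with stable-or-grows w j
  ...   | inj₁ s            = inj₁ (j , ≤-refl , s)
  ...   | inj₂ (u , r , ¬r) = inj₂ (≤-trans (s≤s j<count)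
    (count-< (reach X j w) (reach X (suc j) w) u (λ v → reach≡true ∘ reach-suc {j} {w} {v} ∘ reached)
             (¬-not (¬r ∘ reached)) (reach≡true r)))

  reach-stabilises : ∀ {k w u} → Reach X k w u → Reach X (n X) w u
  reach-stabilises {k} {w} r with k ≤? n X | stable-or-large w (n X)
  ... | yes k≤n | _ = reach-mono k≤n r
  ... | no _    | inj₂ n<count = contradiction (count≤ (reach X (n X) w)) (<⇒≱ n<count)
  ... | no k≰n  | inj₁ (i , i<n , s) =
    reach-mono (<⇒≤ i<n) (stable-persists s (≤⇒≤′ (≤-trans (<⇒≤ i<n) (≰⇒≥ k≰n))) r)

  distAux-nothing : ∀ {k f w u} → distAux X k f w u ≡ nothing → ¬ Reach X (k + f) w u
  distAux-nothing {k} {zero} {w} {u} e r with reach X k w u in eq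
  ... | true  = contradiction e λ ()
  ... | false = not-¬ eq (reach≡true (subst (λ m → Reach X m w u) (+-identityʳ k) r))
  distAux-nothing {k} {suc f} {w} {u} e r with reach X k w u in eq
  ... | true  = contradiction e λ ()
  ... | false = distAux-nothing {suc k} {f} e (subst (λ m → Reach X m w u) (+-suc k f) r)

  dist-nothing : ∀ {k w u} → dist X w u ≡ nothing → ¬ Reach X k w u
  dist-nothing e = distAux-nothing {0} {n X} e ∘ reach-stabilises

  distAux-just : ∀ {k f w u j} → (∀ i → i < k → ¬ Reach X i w u) →
                 distAux X k f w u ≡ just j → Shortest X j w u
  distAux-just {k} {zero} {w} {u} below e with reach X k w u in eq
  ... | true with refl ← just-injective e = reached eq , below
  ... | false = contradiction e λ ()
  distAux-just {k} {suc f} {w} {u} below e with reach X k w u in eq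
  ... | true with refl ← just-injective e = reached eq , below
  ... | false = distAux-just {suc k} {f} below′ e
    where
    below′ : ∀ i → i < suc k → ¬ Reach X i w u
    below′ i i<1+k with m<1+n⇒m<n∨m≡n i<1+k
    ... | inj₁ i<k  = below i i<k
    ... | inj₂ refl = not-¬ eq ∘ reach≡true

  dist-just : ∀ {w u j} → dist X w u ≡ just j → Shortest X j w u
  dist-just = distAux-just {0} {n X} (λ _ ())

  closer⇒Closer : ∀ {w u v} → closer X w u v ≡ true → Closer X w u v
  closer⇒Closer {w} {u} {v} e with dist X w u in eu | dist X w v in ev
  ... | just a  | just b  =
    a , proj₁ (dist-just eu) , proj₂ (dist-just ev) a (<ᵇ⇒< a b (Equivalence.from T-≡ e))
  ... | just a  | nothing = a , proj₁ (dist-just eu) , dist-nothing ev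
  ... | nothing | _       = contradiction e λ ()

  Closer⇒closer : ∀ {w u v} → Closer X w u v → closer X w u v ≡ true
  Closer⇒closer {w} {u} {v} (k , r , ¬r) with dist X w u in eu | dist X w v in ev
  ... | nothing | _       = contradiction r (dist-nothing eu)
  ... | just a  | nothing = refl
  ... | just a  | just b  = Equivalence.to T-≡ (<⇒<ᵇ (≤-<-trans a≤k k<b))
    where
    a≤k : a ≤ k
    a≤k = ≮⇒≥ λ k<a → proj₂ (dist-just eu) k k<a r
    k<b : k < b
    k<b = ≰⇒> λ b≤k → ¬r (reach-mono b≤k (proj₁ (dist-just ev)))

  closer-self : ∀ {u v} → u ≢ v → closer X u u v ≡ true
  closer-self u≢v = Closer⇒closer (0 , reached (≡⇒== refl) , u≢v ∘ reach-zero)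

  closer-asym : ∀ {w u v} → closer X w u v ≡ true → closer X w v u ≡ true → ⊥
  closer-asym uv vu with closer⇒Closer uv | closer⇒Closer vu
  ... | k , ru , ¬rv | k′ , rv , ¬ru with ≤-total k k′
  ...   | inj₁ k≤k′ = ¬ru (reach-mono k≤k′ ru)
  ...   | inj₂ k′≤k = ¬rv (reach-mono k′≤k rv)

  nCloser-pos : ∀ {u v} → u ≢ v → 1 ≤ nCloser X u v
  nCloser-pos {u} {v} u≢v = count-pos (λ w → closer X w u v) u (closer-self u≢v)

  nCloser+nCloser≤n : ∀ u v → nCloser X u v + nCloser X v u ≤ n X
  nCloser+nCloser≤n u v = count+count≤ (λ w → closer X w u v) (λ w → closer X w v u) (λ w → closer-asym {w})

  ∣nCloser-nCloser∣≤n∸2 : ∀ {u v} → u ≢ v → ∣ nCloser X u v - nCloser X v u ∣ ≤ n X ∸ 2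
  ∣nCloser-nCloser∣≤n∸2 {u} {v} u≢v =
    ≤-trans (∣m-n∣≤m+n∸2 (nCloser-pos u≢v) (nCloser-pos (u≢v ∘ sym)))
            (∸-monoˡ-≤ 2 (nCloser+nCloser≤n u v))

  adj⇒≢ : ∀ {u v} → adj X u v ≡ true → u ≢ v
  adj⇒≢ {u} a refl = not-¬ (irrefl X u) a

-- Neighbourhoods and edge sums

exclusive : (X : Graph) → Fin (n X) → Fin (n X) → Fin (n X) → Bool
exclusive X u v y = adj X u y ∧ not (adj X v y)

common : (X : Graph) → Fin (n X) → Fin (n X) → Fin (n X) → Bool
common X u v y = adj X u y ∧ adj X v y

deg≡common+exclusive : ∀ X u v → deg X u ≡ count (common X u v) + count (exclusive X u v)
deg≡common+exclusive X u v = begin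
  deg X u
    ≡⟨ count≡∑ (adj X u) ⟩
  ∑[ y < n X ] indicator (adj X u y)
    ≡⟨ sum-cong-≗ (λ y → split (adj X u y) (adj X v y)) ⟩
  ∑[ y < n X ] (indicator (common X u v y) + indicator (exclusive X u v y))
    ≡⟨ ∑-distrib-+ (indicator ∘ common X u v) (indicator ∘ exclusive X u v) ⟩
  ∑[ y < n X ] indicator (common X u v y) + ∑[ y < n X ] indicator (exclusive X u v y)
    ≡⟨ cong₂ _+_ (count≡∑ (common X u v)) (count≡∑ (exclusive X u v)) ⟨
  count (common X u v) + count (exclusive X u v)
    ∎
  where
  open ≡-Reasoning
  split : ∀ a b → indicator a ≡ indicator (a ∧ b) + indicator (a ∧ not b)
  split false b     = refl
  split true  false = refl
  split true  true  = refl

count-common-comm : ∀ X u v → count (common X u v) ≡ count (common X v u)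
count-common-comm X u v = trans (count≡∑ (common X u v))
  (trans (sum-cong-≗ (λ y → cong indicator (∧-comm (adj X u y) (adj X v y)))) (sym (count≡∑ (common X v u))))

edgeTerm : (X : Graph) → (Fin (n X) → Fin (n X) → ℕ) → Fin (n X) → Fin (n X) → ℕ
edgeTerm X f u v = if adj X u v ∧ (toℕ u <ᵇ toℕ v) then f u v else 0

mostarTerm : (X : Graph) → Fin (n X) → Fin (n X) → ℕ
mostarTerm X u v = ∣ nCloser X u v - nCloser X v u ∣

edgeSum≡∑ : ∀ X f → edgeSum X f ≡ ∑[ u < n X ] ∑[ v < n X ] edgeTerm X f u v
edgeSum≡∑ X f =
  trans (sumFin≡∑ (λ u → sumFin (edgeTerm X f u))) (sum-cong-≗ λ u → sumFin≡∑ (edgeTerm X f u))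

edgeSum-+ : ∀ X f g → edgeSum X (λ u v → f u v + g u v) ≡ edgeSum X f + edgeSum X g
edgeSum-+ X f g = begin
  edgeSum X (λ u v → f u v + g u v)
    ≡⟨ edgeSum≡∑ X _ ⟩
  ∑[ u < n X ] ∑[ v < n X ] edgeTerm X (λ u v → f u v + g u v) u v
    ≡⟨ sum-cong-≗ (λ u → trans (sum-cong-≗ λ v → if-+ (adj X u v ∧ (toℕ u <ᵇ toℕ v)) (f u v) (g u v))
                               (∑-distrib-+ (edgeTerm X f u) (edgeTerm X g u))) ⟩
  ∑[ u < n X ] (∑[ v < n X ] edgeTerm X f u v + ∑[ v < n X ] edgeTerm X g u v)
    ≡⟨ ∑-distrib-+ (λ u → ∑[ v < n X ] edgeTerm X f u v) (λ u → ∑[ v < n X ] edgeTerm X g u v) ⟩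
  ∑[ u < n X ] ∑[ v < n X ] edgeTerm X f u v + ∑[ u < n X ] ∑[ v < n X ] edgeTerm X g u v
    ≡⟨ cong₂ _+_ (edgeSum≡∑ X f) (edgeSum≡∑ X g) ⟨
  edgeSum X f + edgeSum X g
    ∎
  where open ≡-Reasoning

edgeSum-* : ∀ X c f → edgeSum X (λ u v → c * f u v) ≡ c * edgeSum X f
edgeSum-* X c f = begin
  edgeSum X (λ u v → c * f u v)
    ≡⟨ edgeSum≡∑ X _ ⟩
  ∑[ u < n X ] ∑[ v < n X ] edgeTerm X (λ u v → c * f u v) u v
    ≡⟨ sum-cong-≗ (λ u → trans (sum-cong-≗ λ v → if-* (adj X u v ∧ (toℕ u <ᵇ toℕ v)) c (f u v))
                               (sym (*-distribˡ-sum c (edgeTerm X f u)))) ⟩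
  ∑[ u < n X ] (c * ∑[ v < n X ] edgeTerm X f u v)
    ≡⟨ *-distribˡ-sum c (λ u → ∑[ v < n X ] edgeTerm X f u v) ⟨
  c * ∑[ u < n X ] ∑[ v < n X ] edgeTerm X f u v
    ≡⟨ cong (c *_) (edgeSum≡∑ X f) ⟨
  c * edgeSum X f
    ∎
  where open ≡-Reasoning

edgeTerm-nonadjacent : ∀ X f {u v} → adj X u v ≡ false → edgeTerm X f u v ≡ 0
edgeTerm-nonadjacent X f e rewrite e = refl

edgeTerm-descending : ∀ X f {u v} → toℕ v ≤ toℕ u → edgeTerm X f u v ≡ 0
edgeTerm-descending X f {u} {v} v≤u
  rewrite ¬-not (≤⇒≯ v≤u ∘ <ᵇ⇒< (toℕ u) (toℕ v) ∘ Equivalence.from T-≡)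
        | ∧-zeroʳ (adj X u v)
  = refl

-- The corona product

pattern base g   = inj₁ g
pattern copy x h = inj₂ (x , h)

module Corona (G H : Graph) where

  open Distance G

  C : Graph
  C = corona G H

  V : Set
  V = Fin (n G) ⊎ (Fin (n G) × Fin (n H))

  vertex : V → Fin (n C)
  vertex = join (n G) (n G * n H) ∘ Data.Sum.map₂ (uncurry combine)

  decode : Fin (n C) → V
  decode = coronaVertex (n G) (n H)

  decode-vertex : ∀ a → decode (vertex a) ≡ a
  decode-vertex (base g) rewrite Fin.splitAt-↑ˡ (n G) g (n G * n H) = refl
  decode-vertex (copy x h) rewrite Fin.splitAt-↑ʳ (n G) (n G * n H) (combine x h)
                                 | Fin.remQuot-combine {n G} {n H} x h = refl

  vertex-decode : ∀ i → vertex (decode i) ≡ i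
  vertex-decode i with splitAt (n G) i | Fin.join-splitAt (n G) (n G * n H) i
  ... | inj₁ g | eq = eq
  ... | inj₂ p | eq = trans (cong (n G ↑ʳ_) (Fin.combine-remQuot {n G} (n H) p)) eq

  vertex-injective : ∀ {a b} → vertex a ≡ vertex b → a ≡ b
  vertex-injective {a} {b} e = trans (sym (decode-vertex a)) (trans (cong decode e) (decode-vertex b))

  adj-vertex : ∀ a b → adj C (vertex a) (vertex b) ≡ coronaAdjV G H a b
  adj-vertex a b = cong₂ (coronaAdjV G H) (decode-vertex a) (decode-vertex b)

  -- Walks between different copies of H run through G, with one step to leave a copy and
  -- one to enter another.
  CReach : ℕ → V → V → Set
  CReach k             (base x)   (base g)    = Reach G k x g
  CReach zero          (base x)   (copy g h)  = ⊥
  CReach (suc k)       (base x)   (copy g h)  = Reach G k x g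
  CReach zero          (copy x h) (base g)    = ⊥
  CReach (suc k)       (copy x h) (base g)    = Reach G k x g
  CReach zero          (copy x h) (copy y h′) = x ≡ y × h ≡ h′
  CReach (suc zero)    (copy x h) (copy y h′) = x ≡ y × (h ≡ h′ ⊎ adj H h h′ ≡ true)
  CReach (suc (suc k)) (copy x h) (copy y h′) = Reach G k x y

  creach-refl : ∀ a → CReach 0 a a
  creach-refl (base x)   = reach-refl x
  creach-refl (copy x h) = refl , refl

  creach-zero : ∀ {a b} → CReach 0 a b → a ≡ b
  creach-zero {base x}   {base g}   r           = cong base (reach-zero r)
  creach-zero {copy x h} {copy y h′} (refl , refl) = refl

  creach-suc : ∀ {k a b} → CReach k a b → CReach (suc k) a b
  creach-suc {k}           {base x}   {base g}   r             = reach-suc r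
  creach-suc {suc k}       {base x}   {copy g h} r             = reach-suc r
  creach-suc {suc k}       {copy x h} {base g}   r             = reach-suc r
  creach-suc {zero}        {copy x h} {copy y h′} (x≡y , h≡h′) = x≡y , inj₁ h≡h′
  creach-suc {suc zero}    {copy x h} {copy y h′} (x≡y , _)    = reach-≡ x≡y
  creach-suc {suc (suc k)} {copy x h} {copy y h′} r            = reach-suc r

  creach-step : ∀ {k a v b} → CReach k a v → coronaAdjV G H v b ≡ true → CReach (suc k) a b
  creach-step {k}           {base x}   {base y}   {base g}   r e = reach-step r e
  creach-step {k}           {base x}   {base y}   {copy g _} r e with refl ← ==⇒≡ {a = y} {g} e = r
  creach-step {suc k}       {base x}   {copy y _} {base g}   r e
    with refl ← ==⇒≡ {a = y} {g} e = reach-suc (reach-suc r)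
  creach-step {suc k}       {base x}   {copy y _} {copy g _} r e
    with refl ← ==⇒≡ {a = y} {g} (proj₁ (∧-true e)) = reach-suc r
  creach-step {suc k}       {copy x _} {base y}   {base g}   r e = reach-step r e
  creach-step {suc k}       {copy x _} {base y}   {copy g _} r e with refl ← ==⇒≡ {a = y} {g} e = r
  creach-step {zero}        {copy x _} {copy y _} {base g}   (refl , _) e
    with refl ← ==⇒≡ {a = y} {g} e = reach-refl x
  creach-step {suc zero}    {copy x _} {copy y _} {base g}   (refl , _) e
    with refl ← ==⇒≡ {a = y} {g} e = reach-refl x
  creach-step {suc (suc k)} {copy x _} {copy y _} {base g}   r e
    with refl ← ==⇒≡ {a = y} {g} e = reach-suc (reach-suc r)
  creach-step {zero}        {copy x _} {copy y _} {copy g _} (refl , refl) e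
    with refl ← ==⇒≡ {a = y} {g} (proj₁ (∧-true e)) = refl , inj₂ (proj₂ (∧-true e))
  creach-step {suc zero}    {copy x _} {copy y _} {copy g _} (refl , _) e
    with refl ← ==⇒≡ {a = y} {g} (proj₁ (∧-true e)) = reach-refl x
  creach-step {suc (suc k)} {copy x _} {copy y _} {copy g _} r e
    with refl ← ==⇒≡ {a = y} {g} (proj₁ (∧-true e)) = reach-suc r

  creach-inv : ∀ {k a b} → CReach (suc k) a b →
               CReach k a b ⊎ ∃[ v ] CReach k a v × coronaAdjV G H v b ≡ true
  creach-inv {k}     {base x}   {base g}    r with reach-inv r
  ... | inj₁ r′           = inj₁ r′
  ... | inj₂ (y , r′ , e) = inj₂ (base y , r′ , e)
  creach-inv {k}     {base x}   {copy g h}  r = inj₂ (base g , r , ≡⇒== refl)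
  creach-inv {zero}  {copy x h} {base g}    r = inj₂ (copy x h , (refl , refl) , ≡⇒== (reach-zero r))
  creach-inv {suc k} {copy x h} {base g}    r with reach-inv r
  ... | inj₁ r′           = inj₁ r′
  ... | inj₂ (y , r′ , e) = inj₂ (base y , r′ , e)
  creach-inv {zero}  {copy x h} {copy y h′} (x≡y , inj₁ h≡h′) = inj₁ (x≡y , h≡h′)
  creach-inv {zero}  {copy x h} {copy y h′} (refl , inj₂ e)   =
    inj₂ (copy x h , (refl , refl) , cong₂ _∧_ (≡⇒== refl) e)
  creach-inv {suc k} {copy x h} {copy y h′} r = inj₂ (base y , r , ≡⇒== refl)

  module C = Distance C

  reach-corona⇐ : ∀ {k a b} → CReach k a b → Reach C k (vertex a) (vertex b)
  reach-corona⇐ {zero} {a} {b} r with refl ← creach-zero {a} {b} r = C.reach-refl _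
  reach-corona⇐ {suc k} {a} {b} r with creach-inv r
  ... | inj₁ r′           = C.reach-suc (reach-corona⇐ r′)
  ... | inj₂ (v , r′ , e) = C.reach-step (reach-corona⇐ r′) (trans (adj-vertex v b) e)

  reach-corona⇒ : ∀ {k a b} → Reach C k (vertex a) (vertex b) → CReach k a b
  reach-corona⇒ {zero} {a} {b} r with refl ← vertex-injective {a} {b} (C.reach-zero r) = creach-refl a
  reach-corona⇒ {suc k} {a} {b} r with C.reach-inv r
  ... | inj₁ r′           = creach-suc (reach-corona⇒ r′)
  ... | inj₂ (i , r′ , e) = creach-step {v = decode i}
    (reach-corona⇒ (subst (Reach C k (vertex a)) (sym (vertex-decode i)) r′))
    (subst (λ c → coronaAdjV G H (decode i) c ≡ true) (decode-vertex b) e)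

  CCloser : V → V → V → Set
  CCloser w u v = ∃[ k ] CReach k w u × ¬ CReach k w v

  closer-corona⇒ : ∀ {w u v} → closer C (vertex w) (vertex u) (vertex v) ≡ true → CCloser w u v
  closer-corona⇒ e with C.closer⇒Closer e
  ... | k , r , ¬r = k , reach-corona⇒ r , ¬r ∘ reach-corona⇐

  closer-corona⇐ : ∀ {w u v} → CCloser w u v → closer C (vertex w) (vertex u) (vertex v) ≡ true
  closer-corona⇐ (k , r , ¬r) = C.Closer⇒closer (k , reach-corona⇐ r , ¬r ∘ reach-corona⇒)

  ∑-corona : ∀ (f : Fin (n C) → ℕ) →
             sum f ≡ ∑[ z < n G ] f (vertex (base z)) + ∑[ x < n G ] ∑[ h < n H ] f (vertex (copy x h))
  ∑-corona f = trans (∑-↑ (n G) (n G * n H) f)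
                     (cong (∑[ z < n G ] f (vertex (base z)) +_) (∑-combine (n G) (n H) (f ∘ (n G ↑ʳ_))))

  root : V → Fin (n G)
  root (base z)   = z
  root (copy z _) = z

  closer-corona-base : ∀ w g g′ →
    closer C (vertex w) (vertex (base g)) (vertex (base g′)) ≡ closer G (root w) g g′
  closer-corona-base w g g′ =
    ⇔→≡ (mk⇔ (Closer⇒closer ∘ leave w ∘ closer-corona⇒) (closer-corona⇐ ∘ enter w ∘ closer⇒Closer))
    where
    leave : ∀ w → CCloser w (base g) (base g′) → Closer G (root w) g g′
    leave (base z)   c                = c
    leave (copy z h) (suc k , r , ¬r) = k , r , ¬r
    enter : ∀ w → Closer G (root w) g g′ → CCloser w (base g) (base g′)
    enter (base z)   c            = c
    enter (copy z h) (k , r , ¬r) = suc k , r , ¬r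

  nCloser-corona-base : ∀ g g′ →
    nCloser C (vertex (base g)) (vertex (base g′)) ≡ suc (n H) * nCloser G g g′
  nCloser-corona-base g g′ = begin
    nCloser C u v
      ≡⟨ count≡∑ (λ i → closer C i u v) ⟩
    ∑[ i < n C ] indicator (closer C i u v)
      ≡⟨ ∑-corona (λ i → indicator (closer C i u v)) ⟩
    ∑[ z < n G ] indicator (closer C (vertex (base z)) u v)
      + ∑[ x < n G ] ∑[ h < n H ] indicator (closer C (vertex (copy x h)) u v)
      ≡⟨ cong₂ _+_ (sum-cong-≗ λ z → cong indicator (closer-corona-base (base z) g g′))
                   (sum-cong-≗ λ x → trans (sum-cong-≗ λ h → cong indicator (closer-corona-base (copy x h) g g′))
                                           (∑-const (n H) _)) ⟩
    c + ∑[ x < n G ] (n H * indicator (closer G x g g′))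
      ≡⟨ cong (c +_) (*-distribˡ-sum (n H) (λ x → indicator (closer G x g g′))) ⟨
    c + n H * c
      ≡⟨ cong (λ t → t + n H * t) (count≡∑ (λ x → closer G x g g′)) ⟨
    suc (n H) * nCloser G g g′
      ∎
    where
    open ≡-Reasoning
    u = vertex (base g)
    v = vertex (base g′)
    c = ∑[ x < n G ] indicator (closer G x g g′)

  not-closer-from-base : ∀ {y x h h′} → ¬ CCloser (base y) (copy x h) (copy x h′)
  not-closer-from-base (suc k , r , ¬r) = ¬r r

  not-closer-from-other-copy : ∀ {y x h″ h h′} → y ≢ x → ¬ CCloser (copy y h″) (copy x h) (copy x h′)
  not-closer-from-other-copy y≢x (zero         , (y≡x , _) , _) = y≢x y≡x
  not-closer-from-other-copy y≢x (suc zero     , (y≡x , _) , _) = y≢x y≡x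
  not-closer-from-other-copy y≢x (suc (suc k)  , r , ¬r)        = ¬r r

  closer-in-copy⇒ : ∀ {x h″ h h′} → CCloser (copy x h″) (copy x h) (copy x h′) →
                    h″ ≡ h ⊎ exclusive H h h′ h″ ≡ true
  closer-in-copy⇒ (zero     , (_ , h″≡h) , _)       = inj₁ h″≡h
  closer-in-copy⇒ (suc zero , (_ , inj₁ h″≡h) , _)  = inj₁ h″≡h
  closer-in-copy⇒ {x} {h″} {h} {h′} (suc zero , (_ , inj₂ a) , ¬r) =
    inj₂ (cong₂ _∧_ (trans (adjSym H h h″) a)
                    (cong not (trans (adjSym H h′ h″) (¬-not λ a′ → ¬r (refl , inj₂ a′)))))
  closer-in-copy⇒ {x} (suc (suc k) , _ , ¬r) = contradiction (reach-refl x) ¬r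

  closer-in-copy⇐ : ∀ {x h″ h h′} → exclusive H h h′ h″ ≡ true → h″ ≢ h′ →
                    CCloser (copy x h″) (copy x h) (copy x h′)
  closer-in-copy⇐ {x} {h″} {h} {h′} e h″≢h′ =
    1 , (refl , inj₂ (trans (adjSym H h″ h) a)) , λ where
      (_ , inj₁ h″≡h′) → h″≢h′ h″≡h′
      (_ , inj₂ a′)    → not-¬ (Bool.not-injective ¬a) (trans (adjSym H h′ h″) a′)
    where
    a  = proj₁ (∧-true e)
    ¬a = proj₂ (∧-true e)

  closer-copy : Fin (n G) → Fin (n H) → Fin (n H) → Fin (n H) → Bool
  closer-copy x h h′ h″ = closer C (vertex (copy x h″)) (vertex (copy x h)) (vertex (copy x h′))

  nCloser-corona-copy : ∀ x h h′ →
    nCloser C (vertex (copy x h)) (vertex (copy x h′)) ≡ count (closer-copy x h h′)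
  nCloser-corona-copy x h h′ = begin
    nCloser C u v
      ≡⟨ count≡∑ (λ i → closer C i u v) ⟩
    ∑[ i < n C ] indicator (closer C i u v)
      ≡⟨ ∑-corona (λ i → indicator (closer C i u v)) ⟩
    ∑[ z < n G ] indicator (closer C (vertex (base z)) u v)
      + ∑[ y < n G ] ∑[ h″ < n H ] indicator (closer C (vertex (copy y h″)) u v)
      ≡⟨ cong₂ _+_ (∑-zero _ λ z → indicator-false (not-closer-from-base ∘ closer-corona⇒ {base z}))
                   (∑-single _ x λ y y≢x → ∑-zero _ λ h″ →
                      indicator-false (not-closer-from-other-copy y≢x ∘ closer-corona⇒ {copy y h″})) ⟩
    ∑[ h″ < n H ] indicator (closer-copy x h h′ h″)
      ≡⟨ count≡∑ (closer-copy x h h′) ⟨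
    count (closer-copy x h h′)
      ∎
    where
    open ≡-Reasoning
    u = vertex (copy x h)
    v = vertex (copy x h′)

  nCloser-copy≈exclusive : ∀ x h h′ →
    ∣ nCloser C (vertex (copy x h)) (vertex (copy x h′)) - count (exclusive H h h′) ∣ ≤ 1
  nCloser-copy≈exclusive x h h′ rewrite nCloser-corona-copy x h h′ = ∣m-n∣≤1
    (subst (λ c → count (closer-copy x h h′) ≤ c + count (exclusive H h h′)) (count-== h)
      (count≤count+count _ (_== h) _ λ h″ →
        Data.Sum.map₁ ≡⇒== ∘ closer-in-copy⇒ ∘ closer-corona⇒ {copy x h″} {copy x h} {copy x h′}))
    (subst (λ c → count (exclusive H h h′) ≤ c + count (closer-copy x h h′)) (count-== h′)
      (count≤count+count _ (_== h′) _ λ h″ e → case (h″ Fin.≟ h′) of λ where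
        (yes h″≡h′) → inj₁ (≡⇒== h″≡h′)
        (no h″≢h′)  → inj₂ (closer-corona⇐ (closer-in-copy⇐ e h″≢h′))))

  ∣nCloser-nCloser∣-copy : ∀ x h h′ →
    ∣ nCloser C (vertex (copy x h)) (vertex (copy x h′)) - nCloser C (vertex (copy x h′)) (vertex (copy x h)) ∣
      ≤ ∣ deg H h - deg H h′ ∣ + 2
  ∣nCloser-nCloser∣-copy x h h′ = begin
    ∣ nCloser C u v - nCloser C v u ∣
      ≤⟨ ∣m-n∣≤∣p-q∣+2 {nCloser C u v} {nCloser C v u} {e} {e′}
                       (nCloser-copy≈exclusive x h h′) (nCloser-copy≈exclusive x h′ h) ⟩
    ∣ e - e′ ∣ + 2
      ≡⟨ cong (_+ 2) (∣m+n-m+o∣≡∣n-o∣ c e e′) ⟨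
    ∣ c + e - c + e′ ∣ + 2
      ≡⟨ cong₂ (λ s t → ∣ s - t ∣ + 2)
               (deg≡common+exclusive H h h′)
               (trans (deg≡common+exclusive H h′ h) (cong (_+ e′) (count-common-comm H h′ h))) ⟨
    ∣ deg H h - deg H h′ ∣ + 2
      ∎
    where
    open ≤-Reasoning
    u = vertex (copy x h)
    v = vertex (copy x h′)
    c = count (common H h h′)
    e = count (exclusive H h h′)
    e′ = count (exclusive H h′ h)

  degGap : Fin (n H) → Fin (n H) → ℕ
  degGap h h′ = ∣ deg H h - deg H h′ ∣ + 2

  toℕ-base<toℕ-copy : ∀ g x h → toℕ (vertex (base g)) < toℕ (vertex (copy x h))
  toℕ-base<toℕ-copy g x h = begin-strict
    toℕ (g ↑ˡ (n G * n H))            ≡⟨ Fin.toℕ-↑ˡ g (n G * n H) ⟩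
    toℕ g                             <⟨ Fin.toℕ<n g ⟩
    n G                               ≤⟨ m≤m+n (n G) _ ⟩
    n G + toℕ (combine x h)           ≡⟨ Fin.toℕ-↑ʳ (n G) (combine x h) ⟨
    toℕ (n G ↑ʳ combine x h)          ∎
    where open ≤-Reasoning

  <ᵇ-copy : ∀ x h h′ → (toℕ (vertex (copy x h)) <ᵇ toℕ (vertex (copy x h′))) ≡ (toℕ h <ᵇ toℕ h′)
  <ᵇ-copy x h h′
    rewrite Fin.toℕ-↑ʳ (n G) (combine x h) | Fin.toℕ-↑ʳ (n G) (combine x h′)
          | Fin.toℕ-combine x h | Fin.toℕ-combine x h′
          | <ᵇ-+-cancelˡ (n G) (n H * toℕ x + toℕ h) (n H * toℕ x + toℕ h′)
    = <ᵇ-+-cancelˡ (n H * toℕ x) (toℕ h) (toℕ h′)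

  term-base-base : ∀ g g′ → edgeTerm C (mostarTerm C) (vertex (base g)) (vertex (base g′))
                            ≡ suc (n H) * edgeTerm G (mostarTerm G) g g′
  term-base-base g g′
    rewrite adj-vertex (base g) (base g′) | Fin.toℕ-↑ˡ g (n G * n H) | Fin.toℕ-↑ˡ g′ (n G * n H)
          | nCloser-corona-base g g′ | nCloser-corona-base g′ g
          | sym (*-distribˡ-∣-∣ (suc (n H)) (nCloser G g g′) (nCloser G g′ g))
    = if-* (adj G g g′ ∧ (toℕ g <ᵇ toℕ g′)) (suc (n H)) (mostarTerm G g g′)

  term-base-copy : ∀ g y h′ → edgeTerm C (mostarTerm C) (vertex (base g)) (vertex (copy y h′))
                              ≤ (if g == y then ∣ 2 - n C ∣ else 0)
  term-base-copy g y h′ with g == y in eq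
  ... | false = ≤-reflexive
    (edgeTerm-nonadjacent C (mostarTerm C) (trans (adj-vertex (base g) (copy y h′)) eq))
  ... | true  = begin
    edgeTerm C (mostarTerm C) u v   ≤⟨ if-≤ _ _ ⟩
    mostarTerm C u v                ≤⟨ C.∣nCloser-nCloser∣≤n∸2 (C.adj⇒≢ u~v) ⟩
    n C ∸ 2                         ≤⟨ m∸n≤∣m-n∣ (n C) 2 ⟩
    ∣ n C - 2 ∣                     ≡⟨ ∣-∣-comm (n C) 2 ⟩
    ∣ 2 - n C ∣                               ∎
    where
    open ≤-Reasoning
    u = vertex (base g)
    v = vertex (copy y h′)
    u~v : adj C u v ≡ true
    u~v = trans (adj-vertex (base g) (copy y h′)) eq

  term-copy-base : ∀ x h g′ → edgeTerm C (mostarTerm C) (vertex (copy x h)) (vertex (base g′)) ≡ 0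
  term-copy-base x h g′ = edgeTerm-descending C (mostarTerm C) (<⇒≤ (toℕ-base<toℕ-copy g′ x h))

  term-copy-copy : ∀ x h y h′ → edgeTerm C (mostarTerm C) (vertex (copy x h)) (vertex (copy y h′))
                                ≤ (if x == y then edgeTerm H degGap h h′ else 0)
  term-copy-copy x h y h′ with x == y in eq
  ... | false = ≤-reflexive (edgeTerm-nonadjacent C (mostarTerm C)
                               (trans (adj-vertex (copy x h) (copy y h′)) (cong (_∧ adj H h h′) eq)))
  ... | true with refl ← ==⇒≡ {a = x} {y} eq = begin
    edgeTerm C (mostarTerm C) u v
      ≡⟨ cong₂ (λ a o → if a ∧ o then mostarTerm C u v else 0)
               (trans (adj-vertex (copy x h) (copy x h′)) (cong (_∧ adj H h h′) eq)) (<ᵇ-copy x h h′) ⟩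
    (if adj H h h′ ∧ (toℕ h <ᵇ toℕ h′) then mostarTerm C u v else 0)
      ≤⟨ if-mono (adj H h h′ ∧ (toℕ h <ᵇ toℕ h′)) (∣nCloser-nCloser∣-copy x h h′) ⟩
    edgeTerm H degGap h h′
      ∎
    where
    open ≤-Reasoning
    u = vertex (copy x h)
    v = vertex (copy x h′)

  row-base : ∀ g → ∑[ j < n C ] edgeTerm C (mostarTerm C) (vertex (base g)) j
                   ≤ suc (n H) * ∑[ g′ < n G ] edgeTerm G (mostarTerm G) g g′
                     + n H * ∣ 2 - n C ∣
  row-base g = begin
    ∑[ j < n C ] T u j
      ≡⟨ ∑-corona (T u) ⟩
    ∑[ g′ < n G ] T u (vertex (base g′)) + ∑[ y < n G ] ∑[ h′ < n H ] T u (vertex (copy y h′))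
      ≤⟨ +-mono-≤ (≤-reflexive (trans (sum-cong-≗ (term-base-base g))
                                      (sym (*-distribˡ-sum (suc (n H)) (edgeTerm G (mostarTerm G) g)))))
                  (∑-mono-≤ λ y → ∑-mono-≤ λ h′ → term-base-copy g y h′) ⟩
    suc (n H) * ∑[ g′ < n G ] edgeTerm G (mostarTerm G) g g′
      + ∑[ y < n G ] ∑[ h′ < n H ] (if g == y then ∣ 2 - n C ∣ else 0)
      ≡⟨ cong (suc (n H) * ∑[ g′ < n G ] edgeTerm G (mostarTerm G) g g′ +_)
              (trans (∑-select {n G} {n H} g (λ _ → ∣ 2 - n C ∣)) (∑-const (n H) ∣ 2 - n C ∣)) ⟩
    suc (n H) * ∑[ g′ < n G ] edgeTerm G (mostarTerm G) g g′ + n H * ∣ 2 - n C ∣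
      ∎
    where
    open ≤-Reasoning
    T = edgeTerm C (mostarTerm C)
    u = vertex (base g)

  row-copy : ∀ x h → ∑[ j < n C ] edgeTerm C (mostarTerm C) (vertex (copy x h)) j
                     ≤ ∑[ h′ < n H ] edgeTerm H degGap h h′
  row-copy x h = begin
    ∑[ j < n C ] T u j
      ≡⟨ ∑-corona (T u) ⟩
    ∑[ g′ < n G ] T u (vertex (base g′)) + ∑[ y < n G ] ∑[ h′ < n H ] T u (vertex (copy y h′))
      ≤⟨ +-mono-≤ (≤-reflexive (∑-zero _ (term-copy-base x h)))
                  (∑-mono-≤ λ y → ∑-mono-≤ λ h′ → term-copy-copy x h y h′) ⟩
    0 + ∑[ y < n G ] ∑[ h′ < n H ] (if x == y then edgeTerm H degGap h h′ else 0)
      ≡⟨ ∑-select {n G} {n H} x (edgeTerm H degGap h) ⟩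
    ∑[ h′ < n H ] edgeTerm H degGap h h′
      ∎
    where
    open ≤-Reasoning
    T = edgeTerm C (mostarTerm C)
    u = vertex (copy x h)

  edgeSum-degGap : edgeSum H degGap ≡ irr H + 2 * edges H
  edgeSum-degGap = trans (edgeSum-+ H _ (λ _ _ → 2)) (cong (irr H +_) (edgeSum-* H 2 (λ _ _ → 1)))

  Mo-corona-≤ : Mo C ≤ suc (n H) * Mo G + n G * (n H * ∣ 2 - n C ∣)
                       + n G * (irr H + 2 * edges H)
  Mo-corona-≤ = begin
    Mo C
      ≡⟨ edgeSum≡∑ C (mostarTerm C) ⟩
    ∑[ i < n C ] ∑[ j < n C ] T i j
      ≡⟨ ∑-corona (λ i → ∑[ j < n C ] T i j) ⟩
    ∑[ g < n G ] ∑[ j < n C ] T (vertex (base g)) j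
      + ∑[ x < n G ] ∑[ h < n H ] ∑[ j < n C ] T (vertex (copy x h)) j
      ≤⟨ +-mono-≤ (∑-mono-≤ row-base) (∑-mono-≤ λ x → ∑-mono-≤ (row-copy x)) ⟩
    ∑[ g < n G ] (suc (n H) * rowG g + n H * ∣ 2 - n C ∣) + ∑[ x < n G ] ∑[ h < n H ] rowH h
      ≡⟨ cong₂ _+_ base-rows copy-rows ⟩
    suc (n H) * Mo G + n G * (n H * ∣ 2 - n C ∣) + n G * (irr H + 2 * edges H)
      ∎
    where
    open ≤-Reasoning
    T = edgeTerm C (mostarTerm C)
    rowG : Fin (n G) → ℕ
    rowG g = ∑[ g′ < n G ] edgeTerm G (mostarTerm G) g g′
    rowH : Fin (n H) → ℕ
    rowH h = ∑[ h′ < n H ] edgeTerm H degGap h h′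
    base-rows : ∑[ g < n G ] (suc (n H) * rowG g + n H * ∣ 2 - n C ∣)
                ≡ suc (n H) * Mo G + n G * (n H * ∣ 2 - n C ∣)
    base-rows = trans (∑-distrib-+ (λ g → suc (n H) * rowG g) (λ _ → n H * ∣ 2 - n C ∣)) (cong₂ _+_
      (trans (sym (*-distribˡ-sum (suc (n H)) rowG)) (cong (suc (n H) *_) (sym (edgeSum≡∑ G (mostarTerm G)))))
      (∑-const (n G) (n H * ∣ 2 - n C ∣)))
    copy-rows : ∑[ x < n G ] ∑[ h < n H ] rowH h ≡ n G * (irr H + 2 * edges H)
    copy-rows = trans (∑-const (n G) (∑[ h < n H ] rowH h))
                      (cong (n G *_) (trans (sym (edgeSum≡∑ H degGap)) edgeSum-degGap))

regroup : ∀ s₁ s₂ k m i e →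
  suc s₂ * m + s₁ * (s₂ * k) + s₁ * (i + 2 * e) ≡ s₁ * i + (s₂ + 1) * m + s₁ * s₂ * k + 2 * s₁ * e
regroup = solve-∀

theorem1 : (G H : Graph) →
    Mo (corona G H) ≤
      n G * irr H + (n H + 1) * Mo G
      + n G * n H * ∣ 2 - (n G + n G * n H) ∣
      + 2 * n G * edges H
theorem1 G H = ≤-trans (Corona.Mo-corona-≤ G H)
  (≤-reflexive (regroup (n G) (n H) ∣ 2 - (n G + n G * n H) ∣ (Mo G) (irr H) (edges H)))
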